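{- There exists a realizer $\theta\in\mathcal{R}$ such that for every ordinal $\delta$ of $\mathbf{V}$, $\theta\Vdash$ "$\mathfrak{r}(\delta)$ is an $\varepsilon$-ordinal", i.e. $\theta$ realizes $\forall x\,\varepsilon\,\mathfrak{r}(\delta)\,\forall y\,\varepsilon\,x\,(y\,\varepsilon\,\mathfrak{r}(\delta))\ \wedge\ \forall z\,\varepsilon\,\mathfrak{r}(\delta)\,\forall x\,\varepsilon\,z\,\forall y\,\varepsilon\,x\,(y\,\varepsilon\,z)$.
   Context: Setting (Krivine realizability) over a model $\mathbf{V}$ of ZF with realizability algebra $(\Lambda,\Pi,\succ,\perp\!\!\!\perp)$: $\Lambda$ closed $\lambda_c$-terms (variables, application, abstraction, $\mathsf{cc}$, continuation constants $\mathsf{k}_\pi$, possibly special instructions), $\Pi$ stacks (stack bottoms and $t\cdot\pi$), realizers $\mathcal{R}$ = terms without continuation constants, $\succ$ a preorder on processes $t\star\pi$ containing $ts\star\pi\succ t\star s\cdot\pi$, $\lambda u.t\star s\cdot\pi\succ t[u:=s]\star\pi$, $\mathsf{cc}\star t\cdot\pi\succ t\star\mathsf{k}_\pi\cdot\pi$, $\mathsf{k}_\sigma\star t\cdot\pi\succ t\star\sigma$, and a pole $\perp\!\!\!\perp$ closed under anti-reduction. Names $\mathbf{N}=\bigcup_\alpha\mathbf{N}_\alpha$, $\mathbf{N}_\alpha=\bigcup_{\beta<\alpha}\mathcal{P}(\mathbf{N}_\beta\times\Pi)$. Formulas are built from $\top,\perp,a\not\varepsilon b$ (and $a\notin b$,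 $a\subseteq b$) using $\to,\forall$; falsity values $\|\top\|=\emptyset$, $\|\perp\|=\Pi$, $\|a\not\varepsilon b\|=\{\pi:(a,\pi)\in b\}$, $\|\varphi\to\psi\|=\{t\cdot\pi:t\Vdash\varphi,\pi\in\|\psi\|\}$, $\|\forall x\varphi\|=\bigcup_{a\in\mathbf{N}}\|\varphi(a)\|$, with $t\Vdash\varphi$ iff $t\star\pi\in\perp\!\!\!\perp$ for all $\pi\in\|\varphi\|$. Abbreviations: $a\,\varepsilon\,b:=a\not\varepsilon b\to\perp$, $\neg\varphi:=\varphi\to\perp$, $\varphi\wedge\psi:=(\varphi\to(\psi\to\perp))\to\perp$, $\forall x\,\varepsilon\,a\,\varphi(x):=\forall x(\neg\varphi(x)\to x\not\varepsilon a)$. The reish of $x\in\mathbf{V}$ is $\mathfrak{r}(x)=\{(\mathfrak{r}(y),\pi):y\in x,\pi\in\Pi\}$. -}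

module Defs where

open import Level using (Level; Lift; lift) renaming (zero to lzero; suc to lsuc)
open import Data.Nat using (ℕ; zero; suc; _+_; _<_; compare; less; equal; greater)
open import Data.Product using (Σ; _×_; _,_; proj₁; proj₂)
open import Data.Empty using (⊥)
open import Data.Unit using (⊤)
open import Relation.Binary.PropositionalEquality using (_≡_)

-- The ground model V of ZF: Aczel-style well-founded (extensional) sets.

data V : Set₁ where
  sup : (I : Set) → (I → V) → V

_≐_ : V → V → Set
sup I f ≐ sup J g = ((i : I) → Σ J λ j → f i ≐ g j) × ((j : J) → Σ I λ i → f i ≐ g j)

_∈V_ : V → V → Set
x ∈V sup I f = Σ I λ i → x ≐ f i

IsTransitive : V → Set₁
IsTransitive x = (y : V) → y ∈V x → (z : V) → z ∈V y → z ∈V x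

-- von Neumann ordinal: transitive set of transitive sets
-- (equivalent in ZF, thanks to foundation, to "transitive and well-ordered by ∈")
IsOrdinal : V → Set₁
IsOrdinal δ = IsTransitive δ × ((y : V) → y ∈V δ → IsTransitive y)

module K (Instr Bot : Set) where

  infixr 5 _∷_

  mutual
    data Term : Set where
      var   : ℕ → Term              -- de Bruijn index
      app   : Term → Term → Term
      lam   : Term → Term
      cc    : Term
      kont  : Stack → Term
      instr : Instr → Term

    data Stack : Set where
      bot : Bot → Stack
      _∷_ : Term → Stack → Stack

  mutual
    data Scoped (n : ℕ) : Term → Set where
      var   : ∀ {i} → i < n → Scoped n (var i)
      app   : ∀ {t s} → Scoped n t → Scoped n s → Scoped n (app t s)
      lam   : ∀ {t} → Scoped (suc n) t → Scoped n (lam t)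
      cc    : Scoped n cc
      kont  : ∀ {π} → ClosedStack π → Scoped n (kont π)
      instr : ∀ {c} → Scoped n (instr c)

    data ClosedStack : Stack → Set where
      bot : ∀ {b} → ClosedStack (bot b)
      _∷_ : ∀ {t π} → Scoped 0 t → ClosedStack π → ClosedStack (t ∷ π)

  Closed : Term → Set
  Closed = Scoped 0

  data NoKont : Term → Set where
    var   : ∀ {i} → NoKont (var i)
    app   : ∀ {t s} → NoKont t → NoKont s → NoKont (app t s)
    lam   : ∀ {t} → NoKont t → NoKont (lam t)
    cc    : NoKont cc
    instr : ∀ {c} → NoKont (instr c)

  Realizer : Term → Set
  Realizer t = Closed t × NoKont t

  -- substitution of a closed term s for the de Bruijn variable k
  sub : ℕ → Term → Term → Term
  sub k (var i) s with compare i k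
  ... | less .i _    = var i
  ... | equal .k     = s
  ... | greater .k d = var (k + d)
  sub k (app t u) s = app (sub k t s) (sub k u s)
  sub k (lam t) s   = lam (sub (suc k) t s)
  sub k cc s        = cc
  sub k (kont π) s  = kont π
  sub k (instr c) s = instr c

  _[0≔_] : Term → Term → Term
  t [0≔ s ] = sub 0 t s

  record Algebra : Set₁ where
    field
      _≻_      : Term × Stack → Term × Stack → Set
      ≻-refl   : ∀ {p} → p ≻ p
      ≻-trans  : ∀ {p q r} → p ≻ q → q ≻ r → p ≻ r
      ≻-push   : ∀ t s π → Closed t → Closed s → ClosedStack π →
                 (app t s , π) ≻ (t , s ∷ π)
      ≻-grab   : ∀ t s π → Closed (lam t) → Closed s → ClosedStack π →
                 (lam t , s ∷ π) ≻ (t [0≔ s ] , π)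
      ≻-save   : ∀ t π → Closed t → ClosedStack π →
                 (cc , t ∷ π) ≻ (t , kont π ∷ π)
      ≻-restore : ∀ σ t π → ClosedStack σ → Closed t → ClosedStack π →
                 (kont σ , t ∷ π) ≻ (t , σ)
      Pole     : Term × Stack → Set
      Pole-anti : ∀ {p q} → p ≻ q → Pole q → Pole p

  -- names: (well-founded) sets of pairs (name , stack), with stacks in Π

  data Name : Set₁ where
    mk : (I : Set) → (I → Name) → (f : I → Stack) → ((i : I) → ClosedStack (f i)) → Name

  _≈_ : Name → Name → Set
  mk I a f _ ≈ mk J b g _ =
    ((i : I) → Σ J λ j → (a i ≈ b j) × (f i ≡ g j)) ×
    ((j : J) → Σ I λ i → (a i ≈ b j) × (f i ≡ g j))

  PairIn : Name → Stack → Name → Set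
  PairIn a π (mk I b f _) = Σ I λ i → (b i ≈ a) × (f i ≡ π)

  -- the reish  𝔯(x) = {(𝔯(y), π) : y ∈ x, π ∈ Π}
  reish : V → Name
  reish (sup I h) =
    mk (I × Σ Stack ClosedStack) (λ p → reish (h (proj₁ p)))
       (λ p → proj₁ (proj₂ p)) (λ p → proj₂ (proj₂ p))

  infixr 4 _⇒_

  data Formula : Set₁ where
    ⊤F   : Formula
    ⊥F   : Formula
    _∉ε_ : Name → Name → Formula
    _⇒_  : Formula → Formula → Formula
    ∀F   : (Name → Formula) → Formula

  module _ (A : Algebra) where
    open Algebra A

    mutual
      ‖_‖ : Formula → Stack → Set₁
      ‖ ⊤F ‖ π      = Lift (lsuc lzero) ⊥
      ‖ ⊥F ‖ π      = Lift (lsuc lzero) ⊤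
      ‖ a ∉ε b ‖ π  = Lift (lsuc lzero) (PairIn a π b)
      ‖ φ ⇒ ψ ‖ π   = Σ Term λ t → Σ Stack λ ρ →
                        (π ≡ t ∷ ρ) × Closed t × (t ⊩ φ) × ‖ ψ ‖ ρ
      ‖ ∀F φ ‖ π    = Σ Name λ a → ‖ φ a ‖ π

      _⊩_ : Term → Formula → Set₁
      t ⊩ φ = (π : Stack) → ClosedStack π → ‖ φ ‖ π → Lift (lsuc lzero) (Pole (t , π))

  _ε_ : Name → Name → Formula
  a ε b = (a ∉ε b) ⇒ ⊥F

  ¬F : Formula → Formula
  ¬F φ = φ ⇒ ⊥F

  _∧F_ : Formula → Formula → Formula
  φ ∧F ψ = (φ ⇒ (ψ ⇒ ⊥F)) ⇒ ⊥F

  ∀ε : Name → (Name → Formula) → Formula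
  ∀ε a φ = ∀F λ x → ¬F (φ x) ⇒ (x ∉ε a)

  IsεOrdinal : Name → Formula
  IsεOrdinal a =
    (∀ε a λ x → ∀ε x λ y → y ε a) ∧F
    (∀ε a λ z → ∀ε z λ x → ∀ε x λ y → y ε z)

{-# OPTIONS --safe #-}
-- A pair (x , ρ) in 𝔯(δ) has x ≈ 𝔯(y) for some y ∈ δ, and 𝔯(y) contains
-- 𝔯(w) paired with every stack for each w ∈ y. So transitivity of δ and of
-- its elements makes every membership y ε a required by the two conjuncts
-- hold with every stack σ, and λy.y realizes it. A bounded quantifier
-- ∀x ε a φ is then realized by λf.f u, handing the realizer u of φ(x) to the
-- refutation f of φ(x), and the conjunction by the pairing λf.f r₂ r₃.
module Submission where

open import Defs
open import Data.Product using (Σ; _×_; _,_; proj₁; proj₂)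
open import Data.Nat using (_≤_; z≤n; s≤s; compare; less; equal; greater)
open import Data.Nat.Properties using (<-≤-trans; <-irrefl; <-trans; n<1+n; m+n≮m)
open import Data.Empty using (⊥-elim)
open import Data.Unit using (tt)
open import Level using (lift; lower)
open import Relation.Binary.PropositionalEquality using (_≡_; refl; sym; trans; cong; cong₂; subst)

≐-refl : (x : V) → x ≐ x
≐-refl (sup I f) = (λ i → i , ≐-refl (f i)) , (λ i → i , ≐-refl (f i))

module _ (Instr Bot : Set) where
  open K Instr Bot hiding (_⊩_)

  ≈-refl : (a : Name) → a ≈ a
  ≈-refl (mk I a f _) = (λ i → i , ≈-refl (a i) , refl) , (λ i → i , ≈-refl (a i) , refl)

  ≈-sym : ∀ a b → a ≈ b → b ≈ a
  ≈-sym (mk I a f _) (mk J b g _) (p , q) =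
    (λ j → let (i , e , s) = q j in i , ≈-sym (a i) (b j) e , sym s) ,
    (λ i → let (j , e , s) = p i in j , ≈-sym (a i) (b j) e , sym s)

  ≈-trans : ∀ a b c → a ≈ b → b ≈ c → a ≈ c
  ≈-trans (mk I a f _) (mk J b g _) (mk L c h _) (p , q) (p' , q') =
    (λ i → let (j , e , s) = p i ; (l , e' , s') = p' j in
       l , ≈-trans (a i) (b j) (c l) e e' , trans s s') ,
    (λ l → let (j , e' , s') = q' l ; (i , e , s) = q j in
       i , ≈-trans (a i) (b j) (c l) e e' , trans s s')

  reish-cong : ∀ x y → x ≐ y → reish x ≈ reish y
  reish-cong (sup I f) (sup J g) (p , q) =
    (λ is → let (j , e) = p (proj₁ is) in (j , proj₂ is) , reish-cong (f (proj₁ is)) (g j) e , refl) ,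
    (λ js → let (i , e) = q (proj₁ js) in (i , proj₂ js) , reish-cong (f i) (g (proj₁ js)) e , refl)

  ∈reish⁻ : ∀ y a z ρ → reish y ≈ a → PairIn z ρ a → Σ V λ w → (w ∈V y) × (reish w ≈ z)
  ∈reish⁻ (sup I h) (mk J c g _) z ρ (_ , q) (j , e , _) =
    let ((i , _) , e' , _) = q j in
    h i , (i , ≐-refl (h i)) , ≈-trans (reish (h i)) (c j) z e' e

  ∈reish⁺ : ∀ y a w z σ → ClosedStack σ → reish y ≈ a → w ∈V y → reish w ≈ z → PairIn z σ a
  ∈reish⁺ (sup I h) (mk J c g _) w z σ cσ (p , _) (i , w≐hi) e =
    let (j , e' , s) = p (i , σ , cσ) in
    j , ≈-trans (c j) (reish (h i)) z
          (≈-sym (reish (h i)) (c j) e')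
          (≈-trans (reish (h i)) (reish w) z
             (≈-sym (reish w) (reish (h i)) (reish-cong w (h i) w≐hi)) e) ,
        sym s

  reish-transitive : ∀ y a x ρ w ρ' σ → IsTransitive y → ClosedStack σ → reish y ≈ a →
                     PairIn x ρ a → PairIn w ρ' x → PairIn w σ a
  reish-transitive y a x ρ w ρ' σ tr cσ e x∈a w∈x =
    let (y₁ , y₁∈y , e₁) = ∈reish⁻ y a x ρ e x∈a
        (y₂ , y₂∈y₁ , e₂) = ∈reish⁻ y₁ x w ρ' e₁ w∈x
    in ∈reish⁺ y a y₂ w σ cσ e (tr y₁ y₁∈y y₂ y₂∈y₁) e₂

  ∈reish-ordinal : ∀ δ z ρ → IsOrdinal δ → PairIn z ρ (reish δ) →
                   Σ V λ y → IsTransitive y × (reish y ≈ z)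
  ∈reish-ordinal δ z ρ (_ , elem-tr) z∈δ =
    let (y , y∈δ , e) = ∈reish⁻ δ (reish δ) z ρ (≈-refl (reish δ)) z∈δ
    in y , elem-tr y y∈δ , e

  Scoped-weaken : ∀ {m n t} → m ≤ n → Scoped m t → Scoped n t
  Scoped-weaken m≤n (var i<m)  = var (<-≤-trans i<m m≤n)
  Scoped-weaken m≤n (app t s)  = app (Scoped-weaken m≤n t) (Scoped-weaken m≤n s)
  Scoped-weaken m≤n (lam t)    = lam (Scoped-weaken (s≤s m≤n) t)
  Scoped-weaken m≤n cc         = cc
  Scoped-weaken m≤n (kont cπ)  = kont cπ
  Scoped-weaken m≤n instr      = instr

  sub-Scoped : ∀ {n k t} s → n ≤ k → Scoped n t → sub k t s ≡ t
  sub-Scoped {k = k} s n≤k (var {i} i<n) with compare i k | <-≤-trans i<n n≤k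
  ... | less .i _    | _   = refl
  ... | equal .k     | k<k = ⊥-elim (<-irrefl refl k<k)
  ... | greater .k d | i<k = ⊥-elim (m+n≮m k d (<-trans (n<1+n _) i<k))
  sub-Scoped s n≤k (app t u)  = cong₂ app (sub-Scoped s n≤k t) (sub-Scoped s n≤k u)
  sub-Scoped s n≤k (lam t)    = cong lam (sub-Scoped s (s≤s n≤k) t)
  sub-Scoped s n≤k cc         = refl
  sub-Scoped s n≤k (kont _)   = refl
  sub-Scoped s n≤k instr      = refl

  id : Term
  id = lam (var 0)

  ret : Term → Term
  ret u = lam (app (var 0) u)

  pair : Term → Term → Term
  pair t s = lam (app (app (var 0) t) s)

  id-Closed : Closed id
  id-Closed = lam (var (s≤s z≤n))

  ret-Closed : ∀ {u} → Closed u → Closed (ret u)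
  ret-Closed cu = lam (app (var (s≤s z≤n)) (Scoped-weaken z≤n cu))

  pair-Closed : ∀ {t s} → Closed t → Closed s → Closed (pair t s)
  pair-Closed ct cs = lam (app (app (var (s≤s z≤n)) (Scoped-weaken z≤n ct)) (Scoped-weaken z≤n cs))

  id-NoKont : NoKont id
  id-NoKont = lam var

  ret-NoKont : ∀ {u} → NoKont u → NoKont (ret u)
  ret-NoKont nu = lam (app var nu)

  pair-NoKont : ∀ {t s} → NoKont t → NoKont s → NoKont (pair t s)
  pair-NoKont nt ns = lam (app (app var nt) ns)

  θ : Term
  θ = pair (ret (ret id)) (ret (ret (ret id)))

  θ-Realizer : Realizer θ
  θ-Realizer =
    pair-Closed (ret-Closed (ret-Closed id-Closed)) (ret-Closed (ret-Closed (ret-Closed id-Closed))) ,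
    pair-NoKont (ret-NoKont (ret-NoKont id-NoKont)) (ret-NoKont (ret-NoKont (ret-NoKont id-NoKont)))

  IsεTransitive : Name → Formula
  IsεTransitive a = ∀ε a λ x → ∀ε x λ y → y ε a

  module _ (A : Algebra) where
    open Algebra A

    _⊩_ : Term → Formula → Set₁
    _⊩_ = K._⊩_ Instr Bot A

    id⊩ε : ∀ y a → (∀ σ → ClosedStack σ → PairIn y σ a) → id ⊩ (y ε a)
    id⊩ε y a y∈a .(t ∷ σ) (_ ∷ cσ) (t , σ , refl , ct , t⊩ , _) =
      lift (Pole-anti (≻-grab (var 0) t σ id-Closed ct cσ) (lower (t⊩ σ cσ (lift (y∈a σ cσ)))))

    ret⊩∀ε : ∀ u a φ → Closed u → (∀ x ρ → PairIn x ρ a → u ⊩ φ x) → ret u ⊩ ∀ε a φ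
    ret⊩∀ε u a φ cu u⊩ .(f ∷ ρ) (_ ∷ cρ) (x , f , ρ , refl , cf , f⊩ , lift x∈a) =
      lift (Pole-anti (≻-trans grab (≻-push f u ρ cf cu cρ))
        (lower (f⊩ (u ∷ ρ) (cu ∷ cρ) (u , ρ , refl , cu , u⊩ x ρ x∈a , lift tt))))
      where
      grab : (ret u , f ∷ ρ) ≻ (app f u , ρ)
      grab = subst (λ v → (ret u , f ∷ ρ) ≻ (v , ρ)) (cong (app f) (sub-Scoped f z≤n cu))
               (≻-grab (app (var 0) u) f ρ (ret-Closed cu) cf cρ)

    pair⊩∧ : ∀ t s φ ψ → Closed t → Closed s → t ⊩ φ → s ⊩ ψ → pair t s ⊩ (φ ∧F ψ)
    pair⊩∧ t s φ ψ ct cs t⊩ s⊩ .(f ∷ ρ) (_ ∷ cρ) (f , ρ , refl , cf , f⊩ , _) =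
      lift (Pole-anti
        (≻-trans grab (≻-trans (≻-push (app f t) s ρ (app cf ct) cs cρ) (≻-push f t (s ∷ ρ) cf ct (cs ∷ cρ))))
        (lower (f⊩ (t ∷ s ∷ ρ) (ct ∷ cs ∷ cρ)
          (t , s ∷ ρ , refl , ct , t⊩ , (s , ρ , refl , cs , s⊩ , lift tt)))))
      where
      grab : (pair t s , f ∷ ρ) ≻ (app (app f t) s , ρ)
      grab = subst (λ v → (pair t s , f ∷ ρ) ≻ (v , ρ))
               (cong₂ (λ t′ s′ → app (app f t′) s′) (sub-Scoped f z≤n ct) (sub-Scoped f z≤n cs))
               (≻-grab (app (app (var 0) t) s) f ρ (pair-Closed ct cs) cf cρ)

    module _ (δ : V) (ord : IsOrdinal δ) where

      ret²⊩transitive : ret (ret id) ⊩ IsεTransitive (reish δ)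
      ret²⊩transitive =
        ret⊩∀ε (ret id) (reish δ) (λ x → ∀ε x λ y → y ε reish δ) (ret-Closed id-Closed) λ x ρ x∈δ →
        ret⊩∀ε id x (λ y → y ε reish δ) id-Closed λ y ρ' y∈x →
        id⊩ε y (reish δ) λ σ cσ →
        reish-transitive δ (reish δ) x ρ y ρ' σ (proj₁ ord) cσ (≈-refl (reish δ)) x∈δ y∈x

      ret³⊩elements-transitive : ret (ret (ret id)) ⊩ (∀ε (reish δ) IsεTransitive)
      ret³⊩elements-transitive =
        ret⊩∀ε (ret (ret id)) (reish δ) IsεTransitive (ret-Closed (ret-Closed id-Closed)) λ z ρ z∈δ →
        ret⊩∀ε (ret id) z (λ x → ∀ε x λ y → y ε z) (ret-Closed id-Closed) λ x ρ' x∈z →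
        ret⊩∀ε id x (λ y → y ε z) id-Closed λ y ρ'' y∈x →
        id⊩ε y z λ σ cσ →
        let (w , w-tr , e) = ∈reish-ordinal δ z ρ ord z∈δ
        in reish-transitive w z x ρ' y ρ'' σ w-tr cσ e x∈z y∈x

      θ⊩IsεOrdinal : θ ⊩ IsεOrdinal (reish δ)
      θ⊩IsεOrdinal =
        pair⊩∧ (ret (ret id)) (ret (ret (ret id))) (IsεTransitive (reish δ)) (∀ε (reish δ) IsεTransitive)
          (ret-Closed (ret-Closed id-Closed)) (ret-Closed (ret-Closed (ret-Closed id-Closed)))
          ret²⊩transitive ret³⊩elements-transitive

proposition13p6 : (Instr Bot : Set) (A : K.Algebra Instr Bot) →
    Σ (K.Term Instr Bot) λ θ →
      K.Realizer Instr Bot θ ×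
      ((δ : V) → IsOrdinal δ →
        K._⊩_ Instr Bot A θ (K.IsεOrdinal Instr Bot (K.reish Instr Bot δ)))
proposition13p6 Instr Bot A =
  θ Instr Bot , θ-Realizer Instr Bot , θ⊩IsεOrdinal Instr Bot A
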